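{- Let $f\in\mathbb{F}_q[x,y]$ be of degree $d\ge1$ such that for all $u,v\in\mathbb{F}_q$, $f(u,v)$ is a square in $\mathbb{F}_q$ iff $f(v,u)$ is a square in $\mathbb{F}_q$. Let $H$ be the primitive kernel of $f$. If $H$ is a constant multiple of the square of a polynomial, then by removing at most $2d$ vertices and at most $dq$ edges from $X_{f,q}$ one obtains a graph that is either a complete graph, an empty graph, a complete bipartite graph, or the vertex-disjoint union of two complete graphs.
   Context: $q$ is an odd prime power; an element of $\mathbb{F}_q$ is a square if it equals $z^2$ for some $z\in\mathbb{F}_q$ (so $0$ is a square). $X_{f,q}$ is the simple graph on $\mathbb{F}_q$ in which distinct $a,b$ are adjacent iff $f(a,b)$ is a square. Every $f$ can be written $f=F(x)G(y)H(x,y)$ with $F\in\mathbb{F}_q[x]$, $G\in\mathbb{F}_q[y]$ and $H$ primitive in both $x$ and $y$ (no nonconstant factor lying in $\mathbb{F}_q[x]$ or in $\mathbb{F}_q[y]$); $H$, unique up to a constant, is the primitive kernel of $f$. -}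

module Defs where

open import Level using (0ℓ)
open import Algebra.Bundles using (CommutativeRing)
open import Data.Nat as ℕ using (ℕ; zero; suc)
open import Data.Fin using (Fin)
open import Data.Product using (Σ; ∃; ∃-syntax; _×_; _,_; proj₁; proj₂)
open import Data.Sum using (_⊎_)
open import Data.Bool using (Bool)
open import Data.List using (List; length)
open import Data.List.Membership.Propositional using (_∈_)
open import Relation.Nullary using (¬_)
open import Relation.Binary.PropositionalEquality using (_≡_)
open import Function.Bundles using (_⇔_)

-- A finite field of odd order q:
-- a commutative ring (with setoid equality ≈) that is nontrivial, in which
-- every nonzero element is invertible, with 1 + 1 ≉ 0 (odd characteristic),
-- and whose carrier is enumerated, up to ≈, bijectively by Fin q.
-- (Such q is exactly an odd prime power.)
record FiniteOddField : Set₁ where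
  field
    commRing : CommutativeRing 0ℓ 0ℓ
  open CommutativeRing commRing public
  field
    nontrivial : ¬ (1# ≈ 0#)
    inverse    : ∀ x → ¬ (x ≈ 0#) → ∃[ y ] (x * y ≈ 1#)
    oddChar    : ¬ (1# + 1# ≈ 0#)
    q          : ℕ
    enum       : Fin q → Carrier
    enum-surj  : ∀ x → ∃[ i ] (enum i ≈ x)
    enum-inj   : ∀ i j → enum i ≈ enum j → i ≡ j

module _ (𝔽 : FiniteOddField) where
  open FiniteOddField 𝔽 using (Carrier; _≈_; _+_; _*_; 0#; 1#; q)

  -- z is a square (0 counts as a square)
  IsSquare : Carrier → Set
  IsSquare a = ∃[ z ] (z * z ≈ a)

  sumTo : ℕ → (ℕ → Carrier) → Carrier
  sumTo zero    g = g zero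
  sumTo (suc n) g = sumTo n g + g (suc n)

  pow : Carrier → ℕ → Carrier
  pow x zero    = 1#
  pow x (suc n) = x * pow x n

  -- A bivariate polynomial in F_q[x,y], given by its coefficient function:
  -- p i j is the coefficient of x^i y^j.  It must have finite support (IsPoly).
  Coeffs : Set
  Coeffs = ℕ → ℕ → Carrier

  IsPoly : Coeffs → Set
  IsPoly p = ∃[ n ] (∀ i j → n ℕ.< i ℕ.+ j → p i j ≈ 0#)

  _≈ₚ_ : Coeffs → Coeffs → Set
  p ≈ₚ r = ∀ i j → p i j ≈ r i j

  _*ₚ_ : Coeffs → Coeffs → Coeffs
  (p *ₚ r) i j = sumTo i (λ a → sumTo j (λ b → p a b * r (i ℕ.∸ a) (j ℕ.∸ b)))

  scale : Carrier → Coeffs → Coeffs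
  scale c p i j = c * p i j

  HasDegree : Coeffs → ℕ → Set
  HasDegree p d = (∃[ i ] ∃[ j ] (i ℕ.+ j ≡ d × ¬ (p i j ≈ 0#)))
                × (∀ i j → d ℕ.< i ℕ.+ j → p i j ≈ 0#)

  -- evaluation at (u,v) of a polynomial whose coefficients vanish beyond total degree n
  evalUpTo : ℕ → Coeffs → Carrier → Carrier → Carrier
  evalUpTo n p u v = sumTo n (λ i → sumTo n (λ j → p i j * (pow u i * pow v j)))

  OnlyX : Coeffs → Set
  OnlyX p = ∀ i j → 0 ℕ.< j → p i j ≈ 0#

  OnlyY : Coeffs → Set
  OnlyY p = ∀ i j → 0 ℕ.< i → p i j ≈ 0#

  IsConstant : Coeffs → Set
  IsConstant p = ∀ i j → 0 ℕ.< i ℕ.+ j → p i j ≈ 0#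

  _∣ₚ_ : Coeffs → Coeffs → Set
  p ∣ₚ h = ∃[ k ] (IsPoly k × h ≈ₚ (p *ₚ k))

  PrimitiveXY : Coeffs → Set
  PrimitiveXY h = (∀ p → IsPoly p → OnlyX p → p ∣ₚ h → IsConstant p)
                × (∀ p → IsPoly p → OnlyY p → p ∣ₚ h → IsConstant p)

  IsPrimitiveKernel : Coeffs → Coeffs → Set
  IsPrimitiveKernel f h =
    IsPoly h × PrimitiveXY h ×
    ∃[ F ] ∃[ G ] (IsPoly F × IsPoly G × OnlyX F × OnlyY G × f ≈ₚ ((F *ₚ G) *ₚ h))

  ConstTimesSquare : Coeffs → Set
  ConstTimesSquare h = ∃[ c ] ∃[ P ] (IsPoly P × h ≈ₚ scale c (P *ₚ P))

  XAdj : ℕ → Coeffs → Carrier → Carrier → Set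
  XAdj d f a b = ¬ (a ≈ b) × IsSquare (evalUpTo d f a b)

  Alive : List Carrier → Carrier → Set
  Alive S v = ∀ w → w ∈ S → ¬ (w ≈ v)

  Deleted : List (Carrier × Carrier) → Carrier → Carrier → Set
  Deleted E a b = ∃[ e ] (e ∈ E × (  (proj₁ e ≈ a × proj₂ e ≈ b)
                                  ⊎ (proj₁ e ≈ b × proj₂ e ≈ a)))

  RemAdj : (Carrier → Carrier → Set) → List (Carrier × Carrier) → Carrier → Carrier → Set
  RemAdj A E a b = A a b × ¬ Deleted E a b

  IsComplete : (Carrier → Set) → (Carrier → Carrier → Set) → Set
  IsComplete V A = ∀ a b → V a → V b → ¬ (a ≈ b) → A a b

  IsEmptyG : (Carrier → Set) → (Carrier → Carrier → Set) → Set
  IsEmptyG V A = ∀ a b → V a → V b → ¬ A a b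

  IsCompleteBipartite : (Carrier → Set) → (Carrier → Carrier → Set) → Set
  IsCompleteBipartite V A = Σ (Carrier → Bool) λ side →
    (∀ a b → a ≈ b → side a ≡ side b) ×
    (∀ a b → V a → V b → ¬ (a ≈ b) → (A a b ⇔ (¬ (side a ≡ side b))))

  IsTwoCliques : (Carrier → Set) → (Carrier → Carrier → Set) → Set
  IsTwoCliques V A = Σ (Carrier → Bool) λ side →
    (∀ a b → a ≈ b → side a ≡ side b) ×
    (∀ a b → V a → V b → ¬ (a ≈ b) → (A a b ⇔ side a ≡ side b))


  IsSpecialShape : (Carrier → Set) → (Carrier → Carrier → Set) → Set
  IsSpecialShape V A = IsComplete V A ⊎ IsEmptyG V A ⊎ IsCompleteBipartite V A ⊎ IsTwoCliques V A

{-# OPTIONS --safe #-}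
module Submission where

-- Write f = F(x)·G(y)·c·P(x, y)².  Since a product of two non-squares is a square, the quadratic
-- character χ, written additively, satisfies χ(f(u, v)) = α(u) + β(v) wherever f(u, v) ≠ 0, with
-- α = χ(c·F) and β = χ(G).  Choose a vertex a such that neither f(a, ·) nor f(·, a) vanishes
-- identically, and delete the at most 2d roots of these two polynomials.  Symmetry of squareness
-- on the pairs (a, v) forces β(v) = α(v) + g with g = α(a) + β(a), so χ(f(u, v)) = α(u) + α(v) + g:
-- the classes of α form two cliques (g = 0) or the sides of a complete bipartite graph (g = 1).
-- The pairs with f(u, v) = 0 are adjacent regardless; those in the wrong position are at most d
-- per vertex u, and are deleted.  If no such a exists, then either f vanishes on 𝔽² and the graph
-- is complete, or the zeros of one row and one column cover 𝔽, so q ≤ 2d and every vertex is deleted.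

open import Algebra.Bundles using (CommutativeRing)
open import Algebra.Definitions using (AlmostLeftCancellative)
open import Data.Bool.Base using (Bool; true; false; not; _xor_)
import Data.Bool.Properties as Boolₚ
open Boolₚ using (not-involutive; xor-assoc; xor-comm; xor-identityʳ)
open import Data.Empty using (⊥; ⊥-elim)
open import Data.Fin.Base as Fin using (Fin; zero; suc)
import Data.Fin.Properties as Finₚ
open import Data.List.Base using (List; []; _∷_; length; tabulate; applyUpTo; filter; concatMap; map; _++_)
open import Data.List.Membership.Propositional using (_∈_; lose)
open import Data.List.Membership.Propositional.Properties
  using (∈-tabulate⁺; ∈-filter⁺; ∈-map⁺; ∈-concatMap⁺; ∈-++⁺ˡ; ∈-++⁺ʳ)
open import Data.List.Properties
  using (length-tabulate; length-applyUpTo; length-filter; length-++; length-map)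
open import Data.List.Relation.Unary.All as All using (All; []; _∷_)
import Data.List.Relation.Unary.All.Properties as AllP
open AllP using (all-filter)
open import Data.List.Relation.Unary.AllPairs using (AllPairs; []; _∷_)
import Data.List.Relation.Unary.AllPairs.Properties as AllPairs
open import Data.Nat.Base as ℕ using (ℕ; zero; suc; _∸_; _<_; _≤_; z≤n; s≤s)
import Data.Nat.Properties as ℕₚ
open import Algebra.Properties.CommutativeSemigroup ℕₚ.+-commutativeSemigroup
  using () renaming (interchange to +-interchange)
open import Data.Product.Base using (∃; ∃-syntax; _×_; _,_; proj₁; proj₂)
open import Data.Sum.Base using (_⊎_; inj₁; inj₂; [_,_]′)
open import Function.Base using (id; _∘_)
open import Function.Bundles using (_⇔_; mk⇔; Equivalence)
open import Function.Construct.Composition using (_⇔-∘_)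
open import Function.Definitions using (Injective)
open import Level using (_⊔_)
open import Relation.Binary.Definitions using (Decidable; _Respects_)
import Relation.Binary.PropositionalEquality as ≡
open ≡ using (_≡_; _≢_)
open import Relation.Nullary.Decidable as Dec using (Dec; yes; no; does; ¬?; _×-dec_)
open import Relation.Nullary.Negation using (¬_; contradiction)
import Relation.Unary as U

open import Defs

xor≡false⇔≡ : ∀ x y → x xor y ≡ false ⇔ x ≡ y
xor≡false⇔≡ false false = mk⇔ (λ _ → ≡.refl) (λ _ → ≡.refl)
xor≡false⇔≡ false true  = mk⇔ (λ ()) (λ ())
xor≡false⇔≡ true  false = mk⇔ (λ ()) (λ ())
xor≡false⇔≡ true  true  = mk⇔ (λ _ → ≡.refl) (λ _ → ≡.refl)

xor≡true⇔≢ : ∀ x y → x xor y ≡ true ⇔ x ≢ y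
xor≡true⇔≢ false false = mk⇔ (λ ()) (λ x≢x → ⊥-elim (x≢x ≡.refl))
xor≡true⇔≢ false true  = mk⇔ (λ _ ()) (λ _ → ≡.refl)
xor≡true⇔≢ true  false = mk⇔ (λ _ ()) (λ _ → ≡.refl)
xor≡true⇔≢ true  true  = mk⇔ (λ ()) (λ x≢x → ⊥-elim (x≢x ≡.refl))

xor-transpose : ∀ {a b c d} → a xor b ≡ c xor d → b ≡ c xor (a xor d)
xor-transpose {a} {b} {c} {d} eq =
  ≡.trans (≡.sym (xor-cancelˡ a b)) (≡.trans (≡.cong (a xor_) eq) (xor-left-comm a c d))
  where
    xor-cancelˡ : ∀ a b → a xor (a xor b) ≡ b
    xor-cancelˡ false b = ≡.refl
    xor-cancelˡ true  b = not-involutive b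

    xor-left-comm : ∀ a c d → a xor (c xor d) ≡ c xor (a xor d)
    xor-left-comm false c     d = ≡.refl
    xor-left-comm true  false d = ≡.refl
    xor-left-comm true  true  d = ≡.refl

m≤d∧n≤d⇒m+n≤2d : ∀ {m n d} → m ≤ d → n ≤ d → m ℕ.+ n ≤ 2 ℕ.* d
m≤d∧n≤d⇒m+n≤2d {m} {n} {d} m≤d n≤d =
  ≡.subst (m ℕ.+ n ≤_) (≡.cong (d ℕ.+_) (≡.sym (ℕₚ.+-identityʳ d))) (ℕₚ.+-mono-≤ m≤d n≤d)

length-concatMap-≤ : ∀ {A B : Set} {f : A → List B} {n xs} →
                     All (λ x → length (f x) ≤ n) xs → length (concatMap f xs) ≤ n ℕ.* length xs
length-concatMap-≤                          []               = z≤n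
length-concatMap-≤ {f = f} {n} {x ∷ xs} (|fx|≤n ∷ |fxs|≤n) =
  ≡.subst₂ _≤_ (≡.sym (length-++ (f x))) (≡.sym (ℕₚ.*-suc n (length xs)))
    (ℕₚ.+-mono-≤ |fx|≤n (length-concatMap-≤ |fxs|≤n))

length-filter-cover : ∀ {A : Set} {P Q : A → Set} (P? : U.Decidable P) (Q? : U.Decidable Q) {xs} →
                      All (λ x → P x ⊎ Q x) xs → length xs ≤ length (filter P? xs) ℕ.+ length (filter Q? xs)
length-filter-cover P? Q? {[]}     []               = z≤n
length-filter-cover P? Q? {x ∷ xs} (Px⊎Qx ∷ covered) with P? x | Q? x
... | yes _ | yes _ = s≤s (ℕₚ.≤-trans (length-filter-cover P? Q? covered) (ℕₚ.+-monoʳ-≤ _ (ℕₚ.n≤1+n _)))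
... | yes _ | no  _ = s≤s (length-filter-cover P? Q? covered)
... | no  _ | yes _ =
  ≡.subst (suc (length xs) ≤_) (≡.sym (ℕₚ.+-suc _ _)) (s≤s (length-filter-cover P? Q? covered))
... | no ¬Px | no ¬Qx = ⊥-elim ([ ¬Px , ¬Qx ]′ Px⊎Qx)

-- Roots of polynomials over an integral domain

module Horner {ℓ₁ ℓ₂} (R : CommutativeRing ℓ₁ ℓ₂)
  (*-cancelˡ-nonZero :
     AlmostLeftCancellative (CommutativeRing._≈_ R) (CommutativeRing.0# R) (CommutativeRing._*_ R))
  where

  open CommutativeRing R

  open import Algebra.Properties.Ring ring using ([y-z]x≈yx-zx)
  open import Algebra.Properties.Group +-group using (x∙y⁻¹≈ε⇒x≈y; x≈y⇒x∙y⁻¹≈ε)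
  open import Algebra.Solver.Ring.NaturalCoefficients.Default commutativeSemiring
    using (solve; _:=_; _:+_; _:*_; con)
  open import Relation.Binary.Reasoning.Setoid setoid

  horner : List Carrier → Carrier → Carrier
  horner []       y = 0#
  horner (c ∷ cs) y = c + y * horner cs y

  Distinct : List Carrier → Set (ℓ₁ ⊔ ℓ₂)
  Distinct = AllPairs (λ a b → ¬ a ≈ b)

  *-cancelʳ-≉ : ∀ {x y z} → x * z ≈ y * z → ¬ x ≈ y → z ≈ 0#
  *-cancelʳ-≉ {x} {y} {z} xz≈yz x≉y =
    *-cancelˡ-nonZero (x - y) z 0# (x≉y ∘ x∙y⁻¹≈ε⇒x≈y x y) (begin
      (x - y) * z    ≈⟨ [y-z]x≈yx-zx z x y ⟩
      x * z - y * z  ≈⟨ x≈y⇒x∙y⁻¹≈ε xz≈yz ⟩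
      0#             ≈⟨ zeroʳ (x - y) ⟨
      (x - y) * 0#   ∎)

  quotient : Carrier → List Carrier → List Carrier
  quotient r []            = []
  quotient r (c ∷ [])      = []
  quotient r (c ∷ c₁ ∷ cs) = horner (c₁ ∷ cs) r ∷ quotient r (c₁ ∷ cs)

  length-quotient : ∀ r c cs → length (quotient r (c ∷ cs)) ≡ length cs
  length-quotient r c []        = ≡.refl
  length-quotient r c (c₁ ∷ cs) = ≡.cong suc (length-quotient r c₁ cs)

  -- p(y) − p(r) = (y − r)·Q(y), with both sides moved so that no subtraction occurs.
  quotient-spec : ∀ r p y →
    horner p y + r * horner (quotient r p) y ≈ y * horner (quotient r p) y + horner p r
  quotient-spec r []            y =
    solve 2 (λ r y → con 0 :+ r :* con 0 := y :* con 0 :+ con 0) refl r y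
  quotient-spec r (c ∷ [])      y =
    solve 3 (λ c r y → (c :+ y :* con 0) :+ r :* con 0 := y :* con 0 :+ (c :+ r :* con 0)) refl c r y
  quotient-spec r (c ∷ c₁ ∷ cs) y = begin
    (c + y * P) + r * (P[r] + y * Q)
      ≈⟨ solve 6 (λ c y P r P[r] Q → (c :+ y :* P) :+ r :* (P[r] :+ y :* Q)
                                   := (c :+ r :* P[r]) :+ y :* (P :+ r :* Q)) refl c y P r P[r] Q ⟩
    (c + r * P[r]) + y * (P + r * Q)
      ≈⟨ +-congˡ (*-congˡ (quotient-spec r (c₁ ∷ cs) y)) ⟩
    (c + r * P[r]) + y * (y * Q + P[r])
      ≈⟨ solve 5 (λ c y r P[r] Q → (c :+ r :* P[r]) :+ y :* (y :* Q :+ P[r])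
                                 := y :* (P[r] :+ y :* Q) :+ (c :+ r :* P[r])) refl c y r P[r] Q ⟩
    y * (P[r] + y * Q) + (c + r * P[r]) ∎
    where
      P P[r] Q : Carrier
      P = horner (c₁ ∷ cs) y
      P[r] = horner (c₁ ∷ cs) r
      Q = horner (quotient r (c₁ ∷ cs)) y

  horner-constant : ∀ c y → horner (c ∷ []) y ≈ c
  horner-constant c y = trans (+-congˡ (zeroʳ y)) (+-identityʳ c)

  quotient-nonzero : ∀ p {s w} → horner p s ≈ 0# → ¬ horner p w ≈ 0# → ¬ horner (quotient s p) w ≈ 0#
  quotient-nonzero p {s} {w} p[s]≈0 p[w]≉0 Q[w]≈0 = p[w]≉0 (begin
    horner p w                                ≈⟨ +-identityʳ _ ⟨
    horner p w + 0#                           ≈⟨ +-congˡ (trans (*-congˡ Q[w]≈0) (zeroʳ s)) ⟨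
    horner p w + s * horner (quotient s p) w  ≈⟨ quotient-spec s p w ⟩
    w * horner (quotient s p) w + horner p s  ≈⟨ +-cong (trans (*-congˡ Q[w]≈0) (zeroʳ w)) p[s]≈0 ⟩
    0# + 0#                                   ≈⟨ +-identityʳ 0# ⟩
    0#                                        ∎)

  quotient-root : ∀ p {s v} → horner p s ≈ 0# → ¬ s ≈ v → horner p v ≈ 0# → horner (quotient s p) v ≈ 0#
  quotient-root p {s} {v} p[s]≈0 s≉v p[v]≈0 = *-cancelʳ-≉ (begin
    s * Q                      ≈⟨ +-identityˡ _ ⟨
    0# + s * Q                 ≈⟨ +-congʳ p[v]≈0 ⟨
    horner p v + s * Q         ≈⟨ quotient-spec s p v ⟩
    v * Q + horner p s         ≈⟨ +-congˡ p[s]≈0 ⟩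
    v * Q + 0#                 ≈⟨ +-identityʳ _ ⟩
    v * Q                      ∎) s≉v
    where
      Q : Carrier
      Q = horner (quotient s p) v

  roots-length : ∀ p {w} → ¬ horner p w ≈ 0# → ∀ {rs} → Distinct rs →
                 All (λ r → horner p r ≈ 0#) rs → length rs < length p
  roots-length []            p[w]≉0 _ _ = ⊥-elim (p[w]≉0 refl)
  roots-length (c ∷ cs)      p[w]≉0 {[]} _ _ = s≤s z≤n
  roots-length (c ∷ [])      {w} p[w]≉0 {s ∷ _} _ (p[s]≈0 ∷ _) =
    ⊥-elim (p[w]≉0 (trans (horner-constant c w) (trans (sym (horner-constant c s)) p[s]≈0)))
  roots-length p@(c ∷ c₁ ∷ cs) p[w]≉0 {s ∷ rs} (s≉rs ∷ distinct) (p[s]≈0 ∷ p[rs]≈0) =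
    s≤s (≡.subst (length rs <_) (length-quotient s c (c₁ ∷ cs))
      (roots-length (quotient s p) (quotient-nonzero p p[s]≈0 p[w]≉0) distinct
        (All.zipWith (λ (s≉r , p[r]≈0) → quotient-root p p[s]≈0 s≉r p[r]≈0) (s≉rs , p[rs]≈0))))

module _ (𝔽 : FiniteOddField) where
  open FiniteOddField 𝔽 hiding (zero)
  open import Algebra.Solver.Ring.NaturalCoefficients.Default commutativeSemiring
    using (solve; _:=_; _:+_; _:*_; con)
  open import Algebra.Properties.Group +-group using (⁻¹-involutive; inverseˡ-unique; x∙y⁻¹≈ε⇒x≈y)
  open import Relation.Binary.Reasoning.Setoid setoid

  -- The finite field and its squares

  index : Carrier → Fin q
  index x = proj₁ (enum-surj x)

  enum-index : ∀ x → enum (index x) ≈ x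
  enum-index x = proj₂ (enum-surj x)

  index-cong : ∀ {x y} → x ≈ y → index x ≡ index y
  index-cong {x} {y} x≈y = enum-inj _ _ (trans (enum-index x) (trans x≈y (sym (enum-index y))))

  index-injective : ∀ {x y} → index x ≡ index y → x ≈ y
  index-injective {x} {y} eq = trans (sym (enum-index x)) (trans (reflexive (≡.cong enum eq)) (enum-index y))

  infix 4 _≟_
  _≟_ : Decidable _≈_
  x ≟ y = Dec.map′ index-injective index-cong (index x Finₚ.≟ index y)

  ∃? : ∀ {P : Carrier → Set} → (∀ x → Dec (P x)) → P Respects _≈_ → Dec (∃ P)
  ∃? P? resp = Dec.map′ (λ (i , p) → enum i , p) (λ (x , p) → index x , resp (sym (enum-index x)) p)
                        (Finₚ.any? (P? ∘ enum))

  elements : List Carrier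
  elements = tabulate enum

  length-elements : length elements ≡ q
  length-elements = length-tabulate enum

  enum-index∈elements : ∀ x → enum (index x) ∈ elements
  enum-index∈elements x = ∈-tabulate⁺ (index x)

  *-cancelˡ-nonZero : AlmostLeftCancellative _≈_ 0# _*_
  *-cancelˡ-nonZero x y z x≉0 xy≈xz with inverse x x≉0
  ... | x⁻¹ , xx⁻¹≈1 = trans (sym (undo y)) (trans (*-congˡ xy≈xz) (undo z))
    where
      undo : ∀ w → x⁻¹ * (x * w) ≈ w
      undo w = begin
        x⁻¹ * (x * w)  ≈⟨ solve 3 (λ x x⁻¹ w → x⁻¹ :* (x :* w) := (x :* x⁻¹) :* w) refl x x⁻¹ w ⟩
        (x * x⁻¹) * w  ≈⟨ *-congʳ xx⁻¹≈1 ⟩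
        1# * w         ≈⟨ *-identityˡ w ⟩
        w              ∎

  open Horner commRing *-cancelˡ-nonZero

  elements-distinct : Distinct elements
  elements-distinct = AllPairs.tabulate⁺ (λ i≢j eq → i≢j (enum-inj _ _ eq))

  x*y≉0⇒x≉0 : ∀ {x y} → ¬ x * y ≈ 0# → ¬ x ≈ 0#
  x*y≉0⇒x≉0 {x} {y} xy≉0 x≈0 = xy≉0 (trans (*-congʳ x≈0) (zeroˡ y))

  x*y≉0⇒y≉0 : ∀ {x y} → ¬ x * y ≈ 0# → ¬ y ≈ 0#
  x*y≉0⇒y≉0 {x} {y} xy≉0 y≈0 = xy≉0 (trans (*-congˡ y≈0) (zeroʳ x))

  x*x≈0⇒x≈0 : ∀ {x} → x * x ≈ 0# → x ≈ 0#
  x*x≈0⇒x≈0 {x} xx≈0 with x ≟ 0#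
  ... | yes x≈0 = x≈0
  ... | no  x≉0 = *-cancelˡ-nonZero x x 0# x≉0 (trans xx≈0 (sym (zeroʳ x)))

  square-roots : ∀ {z w} → z * z ≈ w * w → z ≈ w ⊎ z ≈ - w
  square-roots {z} {w} zz≈ww with z + w ≟ 0#
  ... | yes z+w≈0 = inj₂ (inverseˡ-unique z w z+w≈0)
  ... | no  z+w≉0 = inj₁ (x∙y⁻¹≈ε⇒x≈y z w
          (*-cancelˡ-nonZero (z + w) (z - w) 0# z+w≉0 (trans product≈0 (sym (zeroʳ (z + w))))))
    where
      product≈0 : (z + w) * (z - w) ≈ 0#
      product≈0 = begin
        (z + w) * (z + - w)
          ≈⟨ solve 3 (λ z w w⁻ → (z :+ w) :* (z :+ w⁻) := (z :* z :+ w⁻ :* w) :+ z :* (w :+ w⁻))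
                     refl z w (- w) ⟩
        (z * z + - w * w) + z * (w + - w)
          ≈⟨ +-cong (+-congʳ zz≈ww) (trans (*-congˡ (-‿inverseʳ w)) (zeroʳ z)) ⟩
        (w * w + - w * w) + 0#             ≈⟨ +-identityʳ _ ⟩
        w * w + - w * w                    ≈⟨ distribʳ w w (- w) ⟨
        (w + - w) * w                      ≈⟨ *-congʳ (-‿inverseʳ w) ⟩
        0# * w                             ≈⟨ zeroˡ w ⟩
        0#                                 ∎

  square? : ∀ a → Dec (IsSquare 𝔽 a)
  square? a = Dec.map′ (λ (i , ii≈a) → enum i , ii≈a)
                       (λ (z , zz≈a) → index z , trans (*-cong (enum-index z) (enum-index z)) zz≈a)
                       (Finₚ.any? (λ i → enum i * enum i ≟ a))

  square-cong : ∀ {a b} → a ≈ b → IsSquare 𝔽 a → IsSquare 𝔽 b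
  square-cong a≈b (z , zz≈a) = z , trans zz≈a a≈b

  square-0# : IsSquare 𝔽 0#
  square-0# = 0# , zeroˡ 0#

  square-* : ∀ {a b} → IsSquare 𝔽 a → IsSquare 𝔽 b → IsSquare 𝔽 (a * b)
  square-* (s , ss≈a) (t , tt≈b) =
    s * t , trans (solve 2 (λ s t → (s :* t) :* (s :* t) := (s :* s) :* (t :* t)) refl s t) (*-cong ss≈a tt≈b)

  square-*-cancelˡ : ∀ {a b} → ¬ a ≈ 0# → IsSquare 𝔽 a → IsSquare 𝔽 (a * b) → IsSquare 𝔽 b
  square-*-cancelˡ {a} {b} a≉0 (s , ss≈a) (t , tt≈ab) with inverse s (x*y≉0⇒x≉0 (a≉0 ∘ trans (sym ss≈a)))
  ... | s⁻¹ , ss⁻¹≈1 = t * s⁻¹ , (begin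
    (t * s⁻¹) * (t * s⁻¹)
      ≈⟨ solve 2 (λ t s⁻¹ → (t :* s⁻¹) :* (t :* s⁻¹) := (t :* t) :* (s⁻¹ :* s⁻¹)) refl t s⁻¹ ⟩
    (t * t) * (s⁻¹ * s⁻¹)
      ≈⟨ *-congʳ (trans tt≈ab (*-congʳ (sym ss≈a))) ⟩
    ((s * s) * b) * (s⁻¹ * s⁻¹)
      ≈⟨ solve 3 (λ s s⁻¹ b → ((s :* s) :* b) :* (s⁻¹ :* s⁻¹) := ((s :* s⁻¹) :* (s :* s⁻¹)) :* b)
                 refl s s⁻¹ b ⟩
    ((s * s⁻¹) * (s * s⁻¹)) * b
      ≈⟨ *-congʳ (*-cong ss⁻¹≈1 ss⁻¹≈1) ⟩
    (1# * 1#) * b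
      ≈⟨ trans (*-congʳ (*-identityˡ 1#)) (*-identityˡ b) ⟩
    b ∎)

  -- If x, y and x·y were all non-squares, then z ↦ z² on the representatives z of {z, −z} with
  -- index z < index (−z), and z ↦ x·z² on the others, would inject 𝔽 into 𝔽 ∖ {y}.
  nonSquare-* : ∀ {x y} → ¬ IsSquare 𝔽 x → ¬ IsSquare 𝔽 y → IsSquare 𝔽 (x * y)
  nonSquare-* {x} {y} x∉□ y∉□ with square? (x * y)
  ... | yes xy∈□ = xy∈□
  ... | no  xy∉□ = ⊥-elim (ℕₚ.n≮n q (Finₚ.injective⇒≤ tagged-injective))
    where
      Positive : Carrier → Set
      Positive z = index z Fin.< index (- z)

      -z≈w : ∀ {z w} → z ≈ - w → - z ≈ w
      -z≈w z≈-w = trans (-‿cong z≈-w) (⁻¹-involutive _)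

      not-both-positive : ∀ {z w} → z ≈ - w → Positive z → Positive w → ⊥
      not-both-positive {z} {w} z≈-w z<-z w<-w = Finₚ.<-irrefl ≡.refl (Finₚ.<-trans
        (≡.subst (index z Fin.<_) (index-cong (-z≈w z≈-w)) z<-z)
        (≡.subst (index w Fin.<_) (index-cong (sym z≈-w)) w<-w))

      both-nonpositive : ∀ {z w} → z ≈ - w → ¬ Positive z → ¬ Positive w → z ≈ w
      both-nonpositive {z} {w} z≈-w z≮-z w≮-w = index-injective (Finₚ.≤-antisym
        (≡.subst (Fin._≤ index w) (index-cong (sym z≈-w)) (ℕₚ.≮⇒≥ w≮-w))
        (≡.subst (Fin._≤ index z) (index-cong (-z≈w z≈-w)) (ℕₚ.≮⇒≥ z≮-z)))

      embed : Carrier → Carrier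
      embed z with index z Finₚ.<? index (- z)
      ... | yes _ = z * z
      ... | no  _ = x * (z * z)

      zz≈xww⇒z≈w : ∀ {z w} → z * z ≈ x * (w * w) → z ≈ w
      zz≈xww⇒z≈w {z} {w} zz≈xww with w ≟ 0#
      ... | yes w≈0 = trans (x*x≈0⇒x≈0 (trans zz≈xww xww≈0)) (sym w≈0)
        where
          xww≈0 : x * (w * w) ≈ 0#
          xww≈0 = trans (*-congˡ (trans (*-congʳ w≈0) (zeroˡ w))) (zeroʳ x)
      ... | no  w≉0 = ⊥-elim (x∉□ (square-*-cancelˡ (w≉0 ∘ x*x≈0⇒x≈0) (w , refl)
                                                      (z , trans zz≈xww (*-comm x (w * w)))))

      embed-injective : ∀ z w → embed z ≈ embed w → z ≈ w
      embed-injective z w eq with index z Finₚ.<? index (- z) | index w Finₚ.<? index (- w)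
      ... | yes z<-z | yes w<-w =
        [ id , (λ z≈-w → ⊥-elim (not-both-positive z≈-w z<-z w<-w)) ]′ (square-roots eq)
      ... | yes _    | no  _    = zz≈xww⇒z≈w eq
      ... | no  _    | yes _    = sym (zz≈xww⇒z≈w (sym eq))
      ... | no  z≮-z | no  w≮-w =
        [ id , (λ z≈-w → both-nonpositive z≈-w z≮-z w≮-w) ]′ (square-roots (*-cancelˡ-nonZero x _ _ x≉0 eq))
        where
          x≉0 : ¬ x ≈ 0#
          x≉0 x≈0 = x∉□ (square-cong (sym x≈0) square-0#)

      y≉embed : ∀ z → ¬ y ≈ embed z
      y≉embed z y≈ with index z Finₚ.<? index (- z)
      ... | yes _ = y∉□ (z , sym y≈)
      ... | no  _ = xy∉□ (x * z , trans (solve 2 (λ x z → (x :* z) :* (x :* z) := x :* (x :* (z :* z))) refl x z)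
                                        (*-congˡ (sym y≈)))

      tagged : Fin (suc q) → Fin q
      tagged zero    = index y
      tagged (suc i) = index (embed (enum i))

      tagged-injective : Injective _≡_ _≡_ tagged
      tagged-injective {zero}  {zero}  _  = ≡.refl
      tagged-injective {zero}  {suc j} eq = ⊥-elim (y≉embed (enum j) (index-injective eq))
      tagged-injective {suc i} {zero}  eq = ⊥-elim (y≉embed (enum i) (index-injective (≡.sym eq)))
      tagged-injective {suc i} {suc j} eq = ≡.cong suc (enum-inj i j (embed-injective _ _ (index-injective eq)))

  -- The quadratic character, written additively in (Bool, xor); χ 0# = false.
  χ : Carrier → Bool
  χ a = not (does (square? a))

  χ-square : ∀ {a} → IsSquare 𝔽 a → χ a ≡ false
  χ-square {a} a∈□ = ≡.cong not (Dec.dec-true (square? a) a∈□)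

  χ-nonSquare : ∀ {a} → ¬ IsSquare 𝔽 a → χ a ≡ true
  χ-nonSquare {a} a∉□ = ≡.cong not (Dec.dec-false (square? a) a∉□)

  χ≡false⇒square : ∀ {a} → χ a ≡ false → IsSquare 𝔽 a
  χ≡false⇒square {a} χa≡false = Dec.decidable-stable (square? a)
    (λ a∉□ → contradiction (≡.trans (≡.sym (χ-nonSquare a∉□)) χa≡false) λ ())

  χ-cong : ∀ {a b} → (IsSquare 𝔽 a → IsSquare 𝔽 b) → (IsSquare 𝔽 b → IsSquare 𝔽 a) → χ a ≡ χ b
  χ-cong {a} a⇒b b⇒a with square? a
  ... | yes a∈□ = ≡.trans (χ-square a∈□) (≡.sym (χ-square (a⇒b a∈□)))
  ... | no  a∉□ = ≡.trans (χ-nonSquare a∉□) (≡.sym (χ-nonSquare (a∉□ ∘ b⇒a)))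

  χ-* : ∀ {a b} → ¬ a ≈ 0# → ¬ b ≈ 0# → χ (a * b) ≡ χ a xor χ b
  χ-* {a} {b} a≉0 b≉0 with square? a | square? b
  ... | yes a∈□ | yes b∈□ = ≡.trans (χ-square (square-* a∈□ b∈□))
                                    (≡.sym (≡.cong₂ _xor_ (χ-square a∈□) (χ-square b∈□)))
  ... | yes a∈□ | no  b∉□ = ≡.trans (χ-nonSquare (b∉□ ∘ square-*-cancelˡ a≉0 a∈□))
                                    (≡.sym (≡.cong₂ _xor_ (χ-square a∈□) (χ-nonSquare b∉□)))
  ... | no  a∉□ | yes b∈□ = ≡.trans (χ-nonSquare (a∉□ ∘ square-*-cancelˡ b≉0 b∈□ ∘ square-cong (*-comm a b)))
                                    (≡.sym (≡.cong₂ _xor_ (χ-nonSquare a∉□) (χ-square b∈□)))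
  ... | no  a∉□ | no  b∉□ = ≡.trans (χ-square (nonSquare-* a∉□ b∉□))
                                    (≡.sym (≡.cong₂ _xor_ (χ-nonSquare a∉□) (χ-nonSquare b∉□)))

  -- Finite sums and evaluation of bivariate polynomials

  ∑ : ℕ → (ℕ → Carrier) → Carrier
  ∑ = sumTo 𝔽

  _^_ : Carrier → ℕ → Carrier
  _^_ = pow 𝔽

  ∑-cong : ∀ n {g h : ℕ → Carrier} → (∀ k → k ≤ n → g k ≈ h k) → ∑ n g ≈ ∑ n h
  ∑-cong zero    g≈h = g≈h 0 z≤n
  ∑-cong (suc n) g≈h = +-cong (∑-cong n (λ k k≤n → g≈h k (ℕₚ.m≤n⇒m≤1+n k≤n))) (g≈h (suc n) ℕₚ.≤-refl)

  ∑-zero : ∀ n {g : ℕ → Carrier} → (∀ k → k ≤ n → g k ≈ 0#) → ∑ n g ≈ 0#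
  ∑-zero zero    g≈0 = g≈0 0 z≤n
  ∑-zero (suc n) g≈0 =
    trans (+-cong (∑-zero n (λ k k≤n → g≈0 k (ℕₚ.m≤n⇒m≤1+n k≤n))) (g≈0 (suc n) ℕₚ.≤-refl)) (+-identityʳ 0#)

  ∑-+ : ∀ n (g h : ℕ → Carrier) → ∑ n (λ k → g k + h k) ≈ ∑ n g + ∑ n h
  ∑-+ zero    g h = refl
  ∑-+ (suc n) g h = trans (+-congʳ (∑-+ n g h))
    (solve 4 (λ a b c e → (a :+ b) :+ (c :+ e) := (a :+ c) :+ (b :+ e))
             refl (∑ n g) (∑ n h) (g (suc n)) (h (suc n)))

  ∑-distribˡ : ∀ n c (g : ℕ → Carrier) → c * ∑ n g ≈ ∑ n (λ k → c * g k)
  ∑-distribˡ zero    c g = refl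
  ∑-distribˡ (suc n) c g = trans (distribˡ c (∑ n g) (g (suc n))) (+-congʳ (∑-distribˡ n c g))

  ∑-distribʳ : ∀ n c (g : ℕ → Carrier) → ∑ n g * c ≈ ∑ n (λ k → g k * c)
  ∑-distribʳ zero    c g = refl
  ∑-distribʳ (suc n) c g = trans (distribʳ c (∑ n g) (g (suc n))) (+-congʳ (∑-distribʳ n c g))

  ∑-swap : ∀ m n (T : ℕ → ℕ → Carrier) → ∑ m (λ i → ∑ n (T i)) ≈ ∑ n (λ j → ∑ m (λ i → T i j))
  ∑-swap zero    n T = refl
  ∑-swap (suc m) n T = trans (+-congʳ (∑-swap m n T)) (sym (∑-+ n (λ j → ∑ m (λ i → T i j)) (T (suc m))))

  ∑-shift : ∀ n (g : ℕ → Carrier) → ∑ (suc n) g ≈ g 0 + ∑ n (g ∘ suc)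
  ∑-shift zero    g = refl
  ∑-shift (suc n) g = trans (+-congʳ (∑-shift n g)) (+-assoc _ _ _)

  ∑-extend : ∀ {m n} {g : ℕ → Carrier} → m ≤ n → (∀ k → m < k → g k ≈ 0#) → ∑ m g ≈ ∑ n g
  ∑-extend {n = zero}  z≤n   _   = refl
  ∑-extend {n = suc n} m≤1+n g≈0 with ℕₚ.m≤n⇒m<n∨m≡n m≤1+n
  ... | inj₂ ≡.refl    = refl
  ... | inj₁ (s≤s m≤n) =
    trans (∑-extend m≤n g≈0) (trans (sym (+-identityʳ _)) (+-congˡ (sym (g≈0 (suc n) (s≤s m≤n)))))

  ∑-triangle : ∀ N (T : ℕ → ℕ → Carrier) →
               ∑ N (λ i → ∑ i (λ a → T a (i ∸ a))) ≈ ∑ N (λ a → ∑ (N ∸ a) (T a))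
  ∑-triangle zero    T = refl
  ∑-triangle (suc N) T = begin
    ∑ N (λ i → ∑ i (λ a → T a (i ∸ a))) + (∑ N (λ a → T a (suc N ∸ a)) + T (suc N) (N ∸ N))
      ≈⟨ +-cong (∑-triangle N T) (+-congˡ (reflexive (≡.cong (T (suc N)) (ℕₚ.n∸n≡0 N)))) ⟩
    ∑ N (λ a → ∑ (N ∸ a) (T a)) + (∑ N (λ a → T a (suc N ∸ a)) + T (suc N) 0)
      ≈⟨ +-assoc _ _ _ ⟨
    (∑ N (λ a → ∑ (N ∸ a) (T a)) + ∑ N (λ a → T a (suc N ∸ a))) + T (suc N) 0
      ≈⟨ +-congʳ (∑-+ N _ _) ⟨
    ∑ N (λ a → ∑ (N ∸ a) (T a) + T a (suc N ∸ a)) + T (suc N) 0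
      ≈⟨ +-cong (∑-cong N extend-column)
                (reflexive (≡.cong (λ k → ∑ k (T (suc N))) (≡.sym (ℕₚ.n∸n≡0 N)))) ⟩
    ∑ N (λ a → ∑ (suc N ∸ a) (T a)) + ∑ (N ∸ N) (T (suc N))  ∎
    where
      extend-column : ∀ a → a ≤ N → ∑ (N ∸ a) (T a) + T a (suc N ∸ a) ≈ ∑ (suc N ∸ a) (T a)
      extend-column a a≤N rewrite ℕₚ.+-∸-assoc 1 a≤N = refl

  +-<⇒<⊎< : ∀ {m n a c} → m ℕ.+ n < a ℕ.+ c → m < a ⊎ n < c
  +-<⇒<⊎< {m} {n} {a} {c} m+n<a+c with m ℕₚ.<? a
  ... | yes m<a = inj₁ m<a
  ... | no  m≮a = inj₂ (ℕₚ.+-cancelˡ-< m n c (ℕₚ.<-≤-trans m+n<a+c (ℕₚ.+-monoˡ-≤ c (ℕₚ.≮⇒≥ m≮a))))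

  ∑-cauchy : ∀ {m n N} {g h : ℕ → Carrier} → (∀ k → m < k → g k ≈ 0#) → (∀ k → n < k → h k ≈ 0#) →
             m ℕ.+ n ≤ N → ∑ N (λ i → ∑ i (λ a → g a * h (i ∸ a))) ≈ ∑ N g * ∑ N h
  ∑-cauchy {m} {n} {N} {g} {h} g≈0 h≈0 m+n≤N = begin
    ∑ N (λ i → ∑ i (λ a → g a * h (i ∸ a)))  ≈⟨ ∑-triangle N (λ a c → g a * h c) ⟩
    ∑ N (λ a → ∑ (N ∸ a) (λ c → g a * h c))  ≈⟨ ∑-cong N (λ a _ → ∑-extend (ℕₚ.m∸n≤m N a) (vanish a)) ⟩
    ∑ N (λ a → ∑ N (λ c → g a * h c))        ≈⟨ ∑-cong N (λ a _ → ∑-distribˡ N (g a) h) ⟨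
    ∑ N (λ a → g a * ∑ N h)                  ≈⟨ ∑-distribʳ N (∑ N h) g ⟨
    ∑ N g * ∑ N h                            ∎
    where
      vanish : ∀ a c → N ∸ a < c → g a * h c ≈ 0#
      vanish a c N∸a<c
        with +-<⇒<⊎< (ℕₚ.≤-<-trans m+n≤N (ℕₚ.≤-<-trans (ℕₚ.m≤n+m∸n N a) (ℕₚ.+-monoʳ-< a N∸a<c)))
      ... | inj₁ m<a = trans (*-congʳ (g≈0 a m<a)) (zeroˡ (h c))
      ... | inj₂ n<c = trans (*-congˡ (h≈0 c n<c)) (zeroʳ (g a))

  ^-cong : ∀ {x y} n → x ≈ y → x ^ n ≈ y ^ n
  ^-cong zero    x≈y = refl
  ^-cong (suc n) x≈y = *-cong x≈y (^-cong n x≈y)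

  ^-+ : ∀ x m n → x ^ (m ℕ.+ n) ≈ x ^ m * x ^ n
  ^-+ x zero    n = sym (*-identityˡ _)
  ^-+ x (suc m) n = trans (*-congˡ (^-+ x m n)) (sym (*-assoc _ _ _))

  ^-split : ∀ x {a i} → a ≤ i → x ^ i ≈ x ^ a * x ^ (i ∸ a)
  ^-split x {a} {i} a≤i = trans (reflexive (≡.cong (x ^_) (≡.sym (ℕₚ.m+[n∸m]≡n a≤i)))) (^-+ x a (i ∸ a))

  DegreeAtMost : ℕ → Coeffs 𝔽 → Set
  DegreeAtMost n p = ∀ i j → n < i ℕ.+ j → p i j ≈ 0#

  eval : ℕ → Coeffs 𝔽 → Carrier → Carrier → Carrier
  eval = evalUpTo 𝔽

  xCoeff : ℕ → Coeffs 𝔽 → Carrier → ℕ → Carrier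
  xCoeff N p y i = ∑ N (λ j → p i j * y ^ j)

  yCoeff : ℕ → Coeffs 𝔽 → Carrier → ℕ → Carrier
  yCoeff N p x j = ∑ N (λ i → p i j * x ^ i)

  eval-by-xCoeff : ∀ N p x y → eval N p x y ≈ ∑ N (λ i → x ^ i * xCoeff N p y i)
  eval-by-xCoeff N p x y = ∑-cong N (λ i _ → trans
    (∑-cong N (λ j _ → solve 3 (λ a X Y → a :* (X :* Y) := X :* (a :* Y)) refl (p i j) (x ^ i) (y ^ j)))
    (sym (∑-distribˡ N (x ^ i) _)))

  eval-by-yCoeff : ∀ N p x y → eval N p x y ≈ ∑ N (λ j → y ^ j * yCoeff N p x j)
  eval-by-yCoeff N p x y = trans (∑-swap N N _) (∑-cong N (λ j _ → trans
    (∑-cong N (λ i _ → solve 3 (λ a X Y → a :* (X :* Y) := Y :* (a :* X)) refl (p i j) (x ^ i) (y ^ j)))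
    (sym (∑-distribˡ N (y ^ j) _))))

  eval-cong : ∀ N p {x x′ y y′} → x ≈ x′ → y ≈ y′ → eval N p x y ≈ eval N p x′ y′
  eval-cong N p x≈x′ y≈y′ =
    ∑-cong N (λ i _ → ∑-cong N (λ j _ → *-congˡ (*-cong (^-cong i x≈x′) (^-cong j y≈y′))))

  eval-congₚ : ∀ N {p r} → _≈ₚ_ 𝔽 p r → ∀ x y → eval N p x y ≈ eval N r x y
  eval-congₚ N p≈r x y = ∑-cong N (λ i _ → ∑-cong N (λ j _ → *-congʳ (p≈r i j)))

  eval-scale : ∀ N c p x y → eval N (scale 𝔽 c p) x y ≈ c * eval N p x y
  eval-scale N c p x y = sym (trans (∑-distribˡ N c _)
    (∑-cong N (λ i _ → trans (∑-distribˡ N c _) (∑-cong N (λ j _ → sym (*-assoc c (p i j) _))))))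

  eval-extend : ∀ {n N p} → DegreeAtMost n p → n ≤ N → ∀ x y → eval n p x y ≈ eval N p x y
  eval-extend {n} {N} {p} p-deg n≤N x y =
    trans (∑-cong n (λ i _ → ∑-extend n≤N (λ j n<j → vanish i j (ℕₚ.<-≤-trans n<j (ℕₚ.m≤n+m j i)))))
          (∑-extend n≤N (λ i n<i → ∑-zero N (λ j _ → vanish i j (ℕₚ.<-≤-trans n<i (ℕₚ.m≤m+n i j)))))
    where
      vanish : ∀ i j → n < i ℕ.+ j → p i j * (x ^ i * y ^ j) ≈ 0#
      vanish i j n<i+j = trans (*-congʳ (p-deg i j n<i+j)) (zeroˡ _)

  eval-onlyX : ∀ N {p} → OnlyX 𝔽 p → ∀ x y y′ → eval N p x y ≈ eval N p x y′
  eval-onlyX N {p} p∈𝔽[x] x y y′ = ∑-cong N (λ i _ → ∑-cong N (λ j _ → same-term i j))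
    where
      same-term : ∀ i j → p i j * (x ^ i * y ^ j) ≈ p i j * (x ^ i * y′ ^ j)
      same-term i zero    = refl
      same-term i (suc j) = trans (*-congʳ (p∈𝔽[x] i (suc j) (s≤s z≤n)))
                                  (trans (zeroˡ _) (sym (trans (*-congʳ (p∈𝔽[x] i (suc j) (s≤s z≤n))) (zeroˡ _))))

  eval-onlyY : ∀ N {p} → OnlyY 𝔽 p → ∀ x x′ y → eval N p x y ≈ eval N p x′ y
  eval-onlyY N {p} p∈𝔽[y] x x′ y = ∑-cong N (λ i _ → ∑-cong N (λ j _ → same-term i j))
    where
      same-term : ∀ i j → p i j * (x ^ i * y ^ j) ≈ p i j * (x′ ^ i * y ^ j)
      same-term zero    j = refl
      same-term (suc i) j = trans (*-congʳ (p∈𝔽[y] (suc i) j (s≤s z≤n)))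
                                  (trans (zeroˡ _) (sym (trans (*-congʳ (p∈𝔽[y] (suc i) j (s≤s z≤n))) (zeroˡ _))))

  degree-*ₚ : ∀ {m n p r} → DegreeAtMost m p → DegreeAtMost n r → DegreeAtMost (m ℕ.+ n) (_*ₚ_ 𝔽 p r)
  degree-*ₚ {m} {n} {p} {r} p-deg r-deg i j m+n<i+j =
    ∑-zero i (λ a a≤i → ∑-zero j (λ b b≤j → vanish a b a≤i b≤j))
    where
      vanish : ∀ a b → a ≤ i → b ≤ j → p a b * r (i ∸ a) (j ∸ b) ≈ 0#
      vanish a b a≤i b≤j with +-<⇒<⊎< (≡.subst (m ℕ.+ n <_) (≡.sym (≡.trans
                                  (+-interchange a b (i ∸ a) (j ∸ b))
                                  (≡.cong₂ ℕ._+_ (ℕₚ.m+[n∸m]≡n a≤i) (ℕₚ.m+[n∸m]≡n b≤j)))) m+n<i+j)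
      ... | inj₁ m<a+b = trans (*-congʳ (p-deg a b m<a+b)) (zeroˡ _)
      ... | inj₂ n<rest = trans (*-congˡ (r-deg _ _ n<rest)) (zeroʳ _)

  xCoeff-*ₚ : ∀ {m n N p r} → DegreeAtMost m p → DegreeAtMost n r → m ℕ.+ n ≤ N → ∀ y i →
              xCoeff N (_*ₚ_ 𝔽 p r) y i ≈ ∑ i (λ a → xCoeff N p y a * xCoeff N r y (i ∸ a))
  xCoeff-*ₚ {m} {n} {N} {p} {r} p-deg r-deg m+n≤N y i = begin
    ∑ N (λ j → ∑ i (λ a → ∑ j (λ b → p a b * r (i ∸ a) (j ∸ b))) * y ^ j)
      ≈⟨ ∑-cong N (λ j _ → ∑-distribʳ i (y ^ j) _) ⟩
    ∑ N (λ j → ∑ i (λ a → ∑ j (λ b → p a b * r (i ∸ a) (j ∸ b)) * y ^ j))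
      ≈⟨ ∑-swap N i _ ⟩
    ∑ i (λ a → ∑ N (λ j → ∑ j (λ b → p a b * r (i ∸ a) (j ∸ b)) * y ^ j))
      ≈⟨ ∑-cong i (λ a _ → row-product a (i ∸ a)) ⟩
    ∑ i (λ a → xCoeff N p y a * xCoeff N r y (i ∸ a))  ∎
    where
      regroup : ∀ a c j b → b ≤ j →
                (p a b * r c (j ∸ b)) * y ^ j ≈ (p a b * y ^ b) * (r c (j ∸ b) * y ^ (j ∸ b))
      regroup a c j b b≤j = trans (*-congˡ (^-split y b≤j))
        (solve 4 (λ P R Y Y′ → (P :* R) :* (Y :* Y′) := (P :* Y) :* (R :* Y′))
                 refl (p a b) (r c (j ∸ b)) (y ^ b) (y ^ (j ∸ b)))

      row-product : ∀ a c →
                    ∑ N (λ j → ∑ j (λ b → p a b * r c (j ∸ b)) * y ^ j) ≈ xCoeff N p y a * xCoeff N r y c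
      row-product a c = begin
        ∑ N (λ j → ∑ j (λ b → p a b * r c (j ∸ b)) * y ^ j)
          ≈⟨ ∑-cong N (λ j _ → trans (∑-distribʳ j (y ^ j) _) (∑-cong j (regroup a c j))) ⟩
        ∑ N (λ j → ∑ j (λ b → (p a b * y ^ b) * (r c (j ∸ b) * y ^ (j ∸ b))))
          ≈⟨ ∑-cauchy (λ b m<b → trans (*-congʳ (p-deg a b (ℕₚ.<-≤-trans m<b (ℕₚ.m≤n+m b a)))) (zeroˡ _))
                      (λ e n<e → trans (*-congʳ (r-deg c e (ℕₚ.<-≤-trans n<e (ℕₚ.m≤n+m e c)))) (zeroˡ _))
                      m+n≤N ⟩
        xCoeff N p y a * xCoeff N r y c  ∎

  eval-*ₚ : ∀ {m n N p r} → DegreeAtMost m p → DegreeAtMost n r → m ℕ.+ n ≤ N → ∀ x y →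
            eval N (_*ₚ_ 𝔽 p r) x y ≈ eval N p x y * eval N r x y
  eval-*ₚ {m} {n} {N} {p} {r} p-deg r-deg m+n≤N x y = begin
    eval N (_*ₚ_ 𝔽 p r) x y
      ≈⟨ eval-by-xCoeff N _ x y ⟩
    ∑ N (λ i → x ^ i * xCoeff N (_*ₚ_ 𝔽 p r) y i)
      ≈⟨ ∑-cong N (λ i _ → *-congˡ (xCoeff-*ₚ p-deg r-deg m+n≤N y i)) ⟩
    ∑ N (λ i → x ^ i * ∑ i (λ a → P a * R (i ∸ a)))
      ≈⟨ ∑-cong N (λ i _ → trans (∑-distribˡ i (x ^ i) _) (∑-cong i (regroup i))) ⟩
    ∑ N (λ i → ∑ i (λ a → (x ^ a * P a) * (x ^ (i ∸ a) * R (i ∸ a))))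
      ≈⟨ ∑-cauchy (vanish p-deg) (vanish r-deg) m+n≤N ⟩
    ∑ N (λ a → x ^ a * P a) * ∑ N (λ c → x ^ c * R c)
      ≈⟨ *-cong (eval-by-xCoeff N p x y) (eval-by-xCoeff N r x y) ⟨
    eval N p x y * eval N r x y  ∎
    where
      P R : ℕ → Carrier
      P = xCoeff N p y
      R = xCoeff N r y

      regroup : ∀ i a → a ≤ i → x ^ i * (P a * R (i ∸ a)) ≈ (x ^ a * P a) * (x ^ (i ∸ a) * R (i ∸ a))
      regroup i a a≤i = trans (*-congʳ (^-split x a≤i))
        (solve 4 (λ X X′ P R → (X :* X′) :* (P :* R) := (X :* P) :* (X′ :* R))
                 refl (x ^ a) (x ^ (i ∸ a)) (P a) (R (i ∸ a)))

      vanish : ∀ {k s} → DegreeAtMost k s → ∀ a → k < a → x ^ a * xCoeff N s y a ≈ 0#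
      vanish s-deg a k<a = trans (*-congˡ (∑-zero N (λ j _ →
        trans (*-congʳ (s-deg a j (ℕₚ.<-≤-trans k<a (ℕₚ.m≤m+n a j)))) (zeroˡ _)))) (zeroʳ _)

  horner-applyUpTo : ∀ n (g : ℕ → Carrier) y → horner (applyUpTo g (suc n)) y ≈ ∑ n (λ j → y ^ j * g j)
  horner-applyUpTo zero    g y =
    trans (trans (+-congˡ (zeroʳ y)) (+-identityʳ (g 0))) (sym (*-identityˡ (g 0)))
  horner-applyUpTo (suc n) g y = begin
    g 0 + y * horner (applyUpTo (g ∘ suc) (suc n)) y
      ≈⟨ +-congˡ (*-congˡ (horner-applyUpTo n (g ∘ suc) y)) ⟩
    g 0 + y * ∑ n (λ j → y ^ j * g (suc j))
      ≈⟨ +-cong (sym (*-identityˡ (g 0)))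
                (trans (∑-distribˡ n y _) (∑-cong n (λ j _ → sym (*-assoc _ _ _)))) ⟩
    1# * g 0 + ∑ n (λ j → (y * y ^ j) * g (suc j))
      ≈⟨ ∑-shift n _ ⟨
    ∑ (suc n) (λ j → y ^ j * g j)  ∎

  rowPoly : ℕ → Coeffs 𝔽 → Carrier → List Carrier
  rowPoly N p x = applyUpTo (yCoeff N p x) (suc N)

  colPoly : ℕ → Coeffs 𝔽 → Carrier → List Carrier
  colPoly N p y = applyUpTo (xCoeff N p y) (suc N)

  horner-rowPoly : ∀ N p x y → horner (rowPoly N p x) y ≈ eval N p x y
  horner-rowPoly N p x y = trans (horner-applyUpTo N _ y) (sym (eval-by-yCoeff N p x y))

  horner-colPoly : ∀ N p x y → horner (colPoly N p y) x ≈ eval N p x y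
  horner-colPoly N p x y = trans (horner-applyUpTo N _ x) (sym (eval-by-xCoeff N p x y))

  row-roots : ∀ N p {x w} → ¬ eval N p x w ≈ 0# → ∀ {ys} → Distinct ys →
              All (λ y → eval N p x y ≈ 0#) ys → length ys ≤ N
  row-roots N p {x} {w} p[x,w]≉0 {ys} distinct roots =
    ℕ.s≤s⁻¹ (≡.subst (length ys <_) (length-applyUpTo (yCoeff N p x) (suc N))
      (roots-length (rowPoly N p x) (p[x,w]≉0 ∘ trans (sym (horner-rowPoly N p x w))) distinct
        (All.map (trans (horner-rowPoly N p x _)) roots)))

  col-roots : ∀ N p {y w} → ¬ eval N p w y ≈ 0# → ∀ {xs} → Distinct xs →
              All (λ x → eval N p x y ≈ 0#) xs → length xs ≤ N
  col-roots N p {y} {w} p[w,y]≉0 {xs} distinct roots =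
    ℕ.s≤s⁻¹ (≡.subst (length xs <_) (length-applyUpTo (xCoeff N p y) (suc N))
      (roots-length (colPoly N p y) (p[w,y]≉0 ∘ trans (sym (horner-colPoly N p w y))) distinct
        (All.map (trans (horner-colPoly N p _ y)) roots)))

  -- The quadratic character of f

  record ProductForm (Φ : Carrier → Carrier → Carrier) : Set where
    field
      U V    : Carrier → Carrier
      W      : Carrier → Carrier → Carrier
      U-cong : ∀ {x x′} → x ≈ x′ → U x ≈ U x′
      factorisation : ∀ x y → Φ x y ≈ (U x * V y) * (W x y * W x y)

  kernel-square⇒productForm : ∀ {f d H} → DegreeAtMost d f → IsPrimitiveKernel 𝔽 f H → ConstTimesSquare 𝔽 H →
                              ProductForm (eval d f)
  kernel-square⇒productForm {f} {d} {H}
    f-deg ((nH , H-deg) , _ , F , G , (nF , F-deg) , (nG , G-deg) , F∈𝔽[x] , G∈𝔽[y] , f≈FGH)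
    (c , P , (nP , P-deg) , H≈cP²) = record
      { U = λ x → c * eval N F x 0#
      ; V = eval N G 0#
      ; W = eval N P
      ; U-cong = λ x≈x′ → *-congˡ (eval-cong N F x≈x′ refl)
      ; factorisation = factorisation
      }
    where
      nFGH N : ℕ
      nFGH = (nF ℕ.+ nG) ℕ.+ nH
      N = d ℕ.+ (nFGH ℕ.+ (nP ℕ.+ nP))

      nFGH≤N : nFGH ≤ N
      nFGH≤N = ℕₚ.≤-trans (ℕₚ.m≤m+n nFGH _) (ℕₚ.m≤n+m _ d)

      nPP≤N : nP ℕ.+ nP ≤ N
      nPP≤N = ℕₚ.≤-trans (ℕₚ.m≤n+m _ nFGH) (ℕₚ.m≤n+m _ d)

      factorisation : ∀ x y →
        eval d f x y ≈ ((c * eval N F x 0#) * eval N G 0# y) * (eval N P x y * eval N P x y)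
      factorisation x y = begin
        eval d f x y
          ≈⟨ trans (eval-extend f-deg (ℕₚ.m≤m+n d _) x y) (eval-congₚ N f≈FGH x y) ⟩
        eval N (_*ₚ_ 𝔽 (_*ₚ_ 𝔽 F G) H) x y
          ≈⟨ eval-*ₚ (degree-*ₚ F-deg G-deg) H-deg nFGH≤N x y ⟩
        eval N (_*ₚ_ 𝔽 F G) x y * eval N H x y
          ≈⟨ *-cong (eval-*ₚ F-deg G-deg (ℕₚ.≤-trans (ℕₚ.m≤m+n _ nH) nFGH≤N) x y)
                    (trans (eval-congₚ N H≈cP² x y) (eval-scale N c _ x y)) ⟩
        (eval N F x y * eval N G x y) * (c * eval N (_*ₚ_ 𝔽 P P) x y)
          ≈⟨ *-cong (*-cong (eval-onlyX N F∈𝔽[x] x y 0#) (eval-onlyY N G∈𝔽[y] x 0# y))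
                    (*-congˡ (eval-*ₚ P-deg P-deg nPP≤N x y)) ⟩
        (eval N F x 0# * eval N G 0# y) * (c * (eval N P x y * eval N P x y))
          ≈⟨ solve 4 (λ F G c P² → (F :* G) :* (c :* P²) := ((c :* F) :* G) :* P²) refl
                     (eval N F x 0#) (eval N G 0# y) c (eval N P x y * eval N P x y) ⟩
        ((c * eval N F x 0#) * eval N G 0# y) * (eval N P x y * eval N P x y)  ∎

  record SeparatedCharacter (Φ : Carrier → Carrier → Carrier) : Set where
    field
      α β         : Carrier → Bool
      α-cong      : ∀ {x x′} → x ≈ x′ → α x ≡ α x′
      χ-separated : ∀ x y → ¬ Φ x y ≈ 0# → χ (Φ x y) ≡ α x xor β y

  productForm⇒separated : ∀ {Φ} → ProductForm Φ → SeparatedCharacter Φ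
  productForm⇒separated {Φ} form = record
    { α = χ ∘ U
    ; β = χ ∘ V
    ; α-cong = λ x≈x′ → χ-cong (square-cong (U-cong x≈x′)) (square-cong (sym (U-cong x≈x′)))
    ; χ-separated = χ-separated
    }
    where
      open ProductForm form

      χ-separated : ∀ x y → ¬ Φ x y ≈ 0# → χ (Φ x y) ≡ χ (U x) xor χ (V y)
      χ-separated x y Φ≉0 = ≡.trans (χ-cong (square-cong factors) (square-cong (sym factors)))
        (≡.trans (χ-* UV≉0 W²≉0)
        (≡.trans (≡.cong (χ (U x * V y) xor_) (χ-square (W x y , refl)))
        (≡.trans (xor-identityʳ _) (χ-* (x*y≉0⇒x≉0 UV≉0) (x*y≉0⇒y≉0 UV≉0)))))
        where
          factors : Φ x y ≈ (U x * V y) * (W x y * W x y)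
          factors = factorisation x y

          UVW²≉0 : ¬ (U x * V y) * (W x y * W x y) ≈ 0#
          UVW²≉0 = Φ≉0 ∘ trans factors

          UV≉0 : ¬ U x * V y ≈ 0#
          UV≉0 = x*y≉0⇒x≉0 UVW²≉0

          W²≉0 : ¬ W x y * W x y ≈ 0#
          W²≉0 = x*y≉0⇒y≉0 UVW²≉0

  -- The graph

  xor-adjacency⇒special : (V : Carrier → Set) (A : Carrier → Carrier → Set) (α : Carrier → Bool) →
                          (∀ {x y} → x ≈ y → α x ≡ α y) → ∀ g →
                          (∀ {u v} → V u → V v → ¬ u ≈ v → A u v ⇔ (α u xor α v ≡ g)) →
                          IsSpecialShape 𝔽 V A
  xor-adjacency⇒special V A α α-cong false adjacency = inj₂ (inj₂ (inj₂ (α , (λ _ _ → α-cong) ,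
    λ u v Vu Vv u≉v → xor≡false⇔≡ (α u) (α v) ⇔-∘ adjacency Vu Vv u≉v)))
  xor-adjacency⇒special V A α α-cong true  adjacency = inj₂ (inj₂ (inj₁ (α , (λ _ _ → α-cong) ,
    λ u v Vu Vv u≉v → xor≡true⇔≢ (α u) (α v) ⇔-∘ adjacency Vu Vv u≉v)))

  enum-index∈⇒dead : ∀ {S v} → enum (index v) ∈ S → ¬ Alive 𝔽 S v
  enum-index∈⇒dead {v = v} v∈S alive = alive _ v∈S (enum-index v)

  module Graph (f : Coeffs 𝔽) (d : ℕ) where

    Φ : Carrier → Carrier → Carrier
    Φ = eval d f

    Φ-cong : ∀ {x x′ y y′} → x ≈ x′ → y ≈ y′ → Φ x y ≈ Φ x′ y′
    Φ-cong = eval-cong d f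

    Result : Set
    Result = ∃[ S ] ∃[ E ] (length S ≤ 2 ℕ.* d × length E ≤ d ℕ.* q ×
                            IsSpecialShape 𝔽 (Alive 𝔽 S) (RemAdj 𝔽 (XAdj 𝔽 d f) E))

    rowZeros : Carrier → List Carrier
    rowZeros x = filter (λ y → Φ x y ≟ 0#) elements

    colZeros : Carrier → List Carrier
    colZeros y = filter (λ x → Φ x y ≟ 0#) elements

    length-rowZeros : ∀ {x w} → ¬ Φ x w ≈ 0# → length (rowZeros x) ≤ d
    length-rowZeros Φ≉0 = row-roots d f Φ≉0 (AllPairs.filter⁺ _ elements-distinct) (all-filter _ elements)

    length-colZeros : ∀ {y w} → ¬ Φ w y ≈ 0# → length (colZeros y) ≤ d
    length-colZeros Φ≉0 = col-roots d f Φ≉0 (AllPairs.filter⁺ _ elements-distinct) (all-filter _ elements)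

    enum-index∈rowZeros : ∀ {x y} → Φ x y ≈ 0# → enum (index y) ∈ rowZeros x
    enum-index∈rowZeros {x} {y} Φ≈0 =
      ∈-filter⁺ _ (enum-index∈elements y) (trans (Φ-cong refl (enum-index y)) Φ≈0)

    enum-index∈colZeros : ∀ {x y} → Φ x y ≈ 0# → enum (index x) ∈ colZeros y
    enum-index∈colZeros {x} {y} Φ≈0 =
      ∈-filter⁺ _ (enum-index∈elements x) (trans (Φ-cong (enum-index x) refl) Φ≈0)

    vanishing-result : (∀ x y → Φ x y ≈ 0#) → Result
    vanishing-result Φ≈0 = [] , [] , z≤n , z≤n ,
      inj₁ (λ u v _ _ u≉v → (u≉v , square-cong (sym (Φ≈0 u v)) square-0#) , λ { (_ , () , _) })

    small-result : q ≤ 2 ℕ.* d → Result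
    small-result q≤2d = elements , [] , ≡.subst (_≤ 2 ℕ.* d) (≡.sym length-elements) q≤2d , z≤n ,
      inj₁ (λ u _ alive _ _ → ⊥-elim (enum-index∈⇒dead (enum-index∈elements u) alive))

    -- Without such a k, the ≤ 2d zeros of Φ(·, b₀) and Φ(a₀, ·) cover 𝔽.
    centre-or-small : ∀ {a₀ b₀} → ¬ Φ a₀ b₀ ≈ 0# → (∃[ k ] (¬ Φ k b₀ ≈ 0# × ¬ Φ a₀ k ≈ 0#)) ⊎ q ≤ 2 ℕ.* d
    centre-or-small {a₀} {b₀} Φ≉0 with ∃? (λ k → ¬? (Φ k b₀ ≟ 0#) ×-dec ¬? (Φ a₀ k ≟ 0#)) respects
      where
        respects : (λ k → ¬ Φ k b₀ ≈ 0# × ¬ Φ a₀ k ≈ 0#) Respects _≈_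
        respects k≈k′ (row≉0 , col≉0) = row≉0 ∘ trans (Φ-cong k≈k′ refl) , col≉0 ∘ trans (Φ-cong refl k≈k′)
    ... | yes centre = inj₁ centre
    ... | no  ¬centre = inj₂ (≡.subst (_≤ 2 ℕ.* d) length-elements
      (ℕₚ.≤-trans (length-filter-cover (λ k → Φ k b₀ ≟ 0#) (λ k → Φ a₀ k ≟ 0#)
                                       (All.universal zero-somewhere elements))
                  (m≤d∧n≤d⇒m+n≤2d (length-colZeros Φ≉0) (length-rowZeros Φ≉0))))
      where
        zero-somewhere : ∀ k → Φ k b₀ ≈ 0# ⊎ Φ a₀ k ≈ 0#
        zero-somewhere k with Φ k b₀ ≟ 0# | Φ a₀ k ≟ 0#
        ... | yes row≈0 | _         = inj₁ row≈0
        ... | no  _     | yes col≈0 = inj₂ col≈0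
        ... | no  row≉0 | no  col≉0 = ⊥-elim (¬centre (k , row≉0 , col≉0))

    module Centred (square-sym : ∀ u v → IsSquare 𝔽 (Φ u v) → IsSquare 𝔽 (Φ v u))
                   (separated : SeparatedCharacter Φ)
                   (a : Carrier) {wr wc : Carrier} (row≉0 : ¬ Φ a wr ≈ 0#) (col≉0 : ¬ Φ wc a ≈ 0#) where
      open SeparatedCharacter separated

      S : List Carrier
      S = rowZeros a ++ colZeros a

      length-S : length S ≤ 2 ℕ.* d
      length-S = ≡.subst (_≤ 2 ℕ.* d) (≡.sym (length-++ (rowZeros a)))
                         (m≤d∧n≤d⇒m+n≤2d (length-rowZeros row≉0) (length-colZeros col≉0))

      alive⇒row≉0 : ∀ {v} → Alive 𝔽 S v → ¬ Φ a v ≈ 0#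
      alive⇒row≉0 alive Φ≈0 = enum-index∈⇒dead (∈-++⁺ˡ (enum-index∈rowZeros Φ≈0)) alive

      alive⇒col≉0 : ∀ {v} → Alive 𝔽 S v → ¬ Φ v a ≈ 0#
      alive⇒col≉0 alive Φ≈0 = enum-index∈⇒dead (∈-++⁺ʳ (rowZeros a) (enum-index∈colZeros Φ≈0)) alive

      g : Bool
      g = α a xor β a

      β-alive : ∀ {v} → Alive 𝔽 S v → β v ≡ α v xor g
      β-alive {v} alive = xor-transpose {α a} {β v} {α v} {β a}
        (≡.trans (≡.sym (χ-separated a v (alive⇒row≉0 alive)))
        (≡.trans (χ-cong (square-sym a v) (square-sym v a))
                 (χ-separated v a (alive⇒col≉0 alive))))

      Linked : Carrier → Carrier → Set
      Linked u v = α u xor α v ≡ g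

      linked? : ∀ u v → Dec (Linked u v)
      linked? u v = α u xor α v Boolₚ.≟ g

      Linked-cong : ∀ {u u′ v v′} → u ≈ u′ → v ≈ v′ → Linked u v → Linked u′ v′
      Linked-cong u≈u′ v≈v′ = ≡.trans (≡.cong₂ _xor_ (≡.sym (α-cong u≈u′)) (≡.sym (α-cong v≈v′)))

      Linked-sym : ∀ {u v} → Linked u v → Linked v u
      Linked-sym {u} {v} = ≡.trans (xor-comm (α v) (α u))

      square⇔linked : ∀ {u v} → Alive 𝔽 S v → ¬ Φ u v ≈ 0# → IsSquare 𝔽 (Φ u v) ⇔ Linked u v
      square⇔linked {u} {v} alive Φ≉0 = mk⇔
        (λ square → Equivalence.to (xor≡false⇔≡ _ g) (≡.trans (≡.sym χ-Φ) (χ-square square)))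
        (λ linked → χ≡false⇒square (≡.trans χ-Φ (Equivalence.from (xor≡false⇔≡ _ g) linked)))
        where
          χ-Φ : χ (Φ u v) ≡ (α u xor α v) xor g
          χ-Φ = ≡.trans (χ-separated u v Φ≉0)
                  (≡.trans (≡.cong (α u xor_) (β-alive alive)) (≡.sym (xor-assoc (α u) (α v) g)))

      unlinkedZeros : Carrier → List Carrier
      unlinkedZeros u = filter (λ v → ¬? (linked? u v)) (rowZeros u)

      wrongZerosAt : Carrier → List (Carrier × Carrier)
      wrongZerosAt u = map (u ,_) (unlinkedZeros u)

      source? : ∀ u → Dec (¬ Φ u a ≈ 0#)
      source? u = ¬? (Φ u a ≟ 0#)

      sources : List Carrier
      sources = filter source? elements

      E : List (Carrier × Carrier)
      E = concatMap wrongZerosAt sources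

      length-E : length E ≤ d ℕ.* q
      length-E = ℕₚ.≤-trans
        (length-concatMap-≤ {xs = sources} (All.map length-wrongZerosAt (all-filter source? elements)))
        (ℕₚ.*-monoʳ-≤ d (≡.subst (length sources ≤_) length-elements (length-filter source? elements)))
        where
          length-wrongZerosAt : ∀ {u} → ¬ Φ u a ≈ 0# → length (wrongZerosAt u) ≤ d
          length-wrongZerosAt {u} Φ≉0 = ≡.subst (_≤ d) (≡.sym (length-map (u ,_) (unlinkedZeros u)))
            (ℕₚ.≤-trans (length-filter (λ v → ¬? (linked? u v)) (rowZeros u)) (length-rowZeros Φ≉0))

      E-unlinked : All (λ (u , v) → ¬ Linked u v) E
      E-unlinked = AllP.concat⁺ (AllP.map⁺ (All.universal unlinked-at sources))
        where
          unlinked-at : ∀ u → All (λ (u , v) → ¬ Linked u v) (wrongZerosAt u)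
          unlinked-at u = AllP.map⁺ (all-filter (λ v → ¬? (linked? u v)) (rowZeros u))

      deleted⇒¬linked : ∀ {u v} → Deleted 𝔽 E u v → ¬ Linked u v
      deleted⇒¬linked (e , e∈E , inj₁ (e₁≈u , e₂≈v)) linked =
        All.lookup E-unlinked e∈E (Linked-cong (sym e₁≈u) (sym e₂≈v) linked)
      deleted⇒¬linked (e , e∈E , inj₂ (e₁≈v , e₂≈u)) linked =
        All.lookup E-unlinked e∈E (Linked-cong (sym e₁≈v) (sym e₂≈u) (Linked-sym linked))

      ¬linked⇒deleted : ∀ {u v} → Alive 𝔽 S u → Φ u v ≈ 0# → ¬ Linked u v → Deleted 𝔽 E u v
      ¬linked⇒deleted {u} {v} alive Φ≈0 ¬linked =
        (u′ , v′) , ∈-concatMap⁺ wrongZerosAt (lose u′∈sources (∈-map⁺ (u′ ,_) v′∈wrong)) ,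
        inj₁ (enum-index u , enum-index v)
        where
          u′ v′ : Carrier
          u′ = enum (index u)
          v′ = enum (index v)

          u′∈sources : u′ ∈ sources
          u′∈sources = ∈-filter⁺ source? (enum-index∈elements u)
                                 (alive⇒col≉0 alive ∘ trans (Φ-cong (sym (enum-index u)) refl))

          v′∈wrong : v′ ∈ unlinkedZeros u′
          v′∈wrong = ∈-filter⁺ (λ v → ¬? (linked? u′ v))
                               (enum-index∈rowZeros (trans (Φ-cong (enum-index u) refl) Φ≈0))
                               (¬linked ∘ Linked-cong (enum-index u) (enum-index v))

      adjacent⇔linked : ∀ {u v} → Alive 𝔽 S u → Alive 𝔽 S v → ¬ u ≈ v →
                        RemAdj 𝔽 (XAdj 𝔽 d f) E u v ⇔ Linked u v
      adjacent⇔linked {u} {v} alive-u alive-v u≉v = mk⇔ to from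
        where
          to : RemAdj 𝔽 (XAdj 𝔽 d f) E u v → Linked u v
          to ((_ , square) , ¬deleted) with Φ u v ≟ 0#
          ... | yes Φ≈0 = Dec.decidable-stable (linked? u v) (¬deleted ∘ ¬linked⇒deleted alive-u Φ≈0)
          ... | no  Φ≉0 = Equivalence.to (square⇔linked alive-v Φ≉0) square

          square : Linked u v → IsSquare 𝔽 (Φ u v)
          square linked with Φ u v ≟ 0#
          ... | yes Φ≈0 = square-cong (sym Φ≈0) square-0#
          ... | no  Φ≉0 = Equivalence.from (square⇔linked alive-v Φ≉0) linked

          from : Linked u v → RemAdj 𝔽 (XAdj 𝔽 d f) E u v
          from linked = (u≉v , square linked) , (λ deleted → deleted⇒¬linked deleted linked)

      result : Result
      result = S , E , length-S , length-E ,
               xor-adjacency⇒special (Alive 𝔽 S) (RemAdj 𝔽 (XAdj 𝔽 d f) E) α α-cong g adjacent⇔linked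

    result : (∀ u v → IsSquare 𝔽 (Φ u v) → IsSquare 𝔽 (Φ v u)) → SeparatedCharacter Φ → Result
    result square-sym separated with ∃? (λ x → ∃? (λ y → ¬? (Φ x y ≟ 0#)) (row-respects x)) column-respects
      where
        row-respects : ∀ x → (λ y → ¬ Φ x y ≈ 0#) Respects _≈_
        row-respects x y≈y′ Φ≉0 = Φ≉0 ∘ trans (Φ-cong refl y≈y′)
        column-respects : (λ x → ∃[ y ] ¬ Φ x y ≈ 0#) Respects _≈_
        column-respects x≈x′ (y , Φ≉0) = y , Φ≉0 ∘ trans (Φ-cong x≈x′ refl)
    ... | no  Φ≡0 =
      vanishing-result (λ x y → Dec.decidable-stable (Φ x y ≟ 0#) (λ Φ≉0 → Φ≡0 (x , y , Φ≉0)))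
    ... | yes (a₀ , b₀ , Φ≉0) with centre-or-small Φ≉0
    ...   | inj₁ (a , row≉0 , col≉0) = Centred.result square-sym separated a row≉0 col≉0
    ...   | inj₂ q≤2d                = small-result q≤2d

open import Data.Nat.Base using (_*_)
open FiniteOddField using (Carrier; _≈_)

lemma3p2 : (𝔽 : FiniteOddField) (f : Coeffs 𝔽) (d : ℕ) →
    1 ≤ d → HasDegree 𝔽 f d →
    (∀ u v → (IsSquare 𝔽 (evalUpTo 𝔽 d f u v) → IsSquare 𝔽 (evalUpTo 𝔽 d f v u))
           × (IsSquare 𝔽 (evalUpTo 𝔽 d f v u) → IsSquare 𝔽 (evalUpTo 𝔽 d f u v))) →
    (H : Coeffs 𝔽) → IsPrimitiveKernel 𝔽 f H → ConstTimesSquare 𝔽 H →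
    ∃[ S ] ∃[ E ]
      (length {A = Carrier 𝔽} S ≤ 2 * d × length E ≤ d * FiniteOddField.q 𝔽 ×
       IsSpecialShape 𝔽 (Alive 𝔽 S) (RemAdj 𝔽 (XAdj 𝔽 d f) E))
lemma3p2 𝔽 f d _ (_ , f-deg) symmetric H kernel H-square =
  Graph.result 𝔽 f d (λ u v → proj₁ (symmetric u v))
    (productForm⇒separated 𝔽 (kernel-square⇒productForm 𝔽 f-deg kernel H-square))
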